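{- For a functional PTS specification with EPTS and Dedukti encoding, for all EPTS terms $M,N$: (1) if $M\hookrightarrow N$ then $[\![M]\!]\hookrightarrow^*_{\beta\mathscr R_{EPTS}}[\![N]\!]$; (2) if $M\equiv N$ then $[\![M]\!]\equiv[\![N]\!]$ in Dedukti.
   Context: Functional PTS specification $(\mathcal S,\mathcal A,\mathcal R)$. EPTS terms $x\mid s\mid\Pi_{s_1,s_2}(A,x.B)\mid\lambda_{s_1,s_2}(A,x.B,x.M)\mid@_{s_1,s_2}(A,x.B,M,N)$; EPTS reduction $\hookrightarrow$ is the context closure of $@_{s_1,s_2}(A,x.B,\lambda_{s_1,s_2}(A',x.B',x.M),N)\hookrightarrow M\{N/x\}$ for $(s_1,s_2,s_3)\in\mathcal R$, and $\equiv$ its equivalence. Dedukti theory $(\Sigma_{EPTS},\mathscr R_{EPTS})$: constants $\mathbf U_s$, $\mathbf{El}_s$ ($s\in\mathcal S$), $\mathbf u_{s_1}$ with rule $\mathbf{El}_{s_2}\mathbf u_{s_1}\hookrightarrow\mathbf U_{s_1}$ ($(s_1,s_2)\in\mathcal A$), and for $(s_1,s_2,s_3)\in\mathcal R$ constants $\mathbf{Prod}_{s_1,s_2}$ (arity 2), $\mathbf{abs}_{s_1,s_2}$ (arity 3), $\mathbf{app}_{s_1,s_2}$ (arity 4) with rule $\mathbf{app}_{s_1,s_2}AB(\mathbf{abs}_{s_1,s_2}A'B'M)N\hookrightarrow MN$; Dedukti reduction is $\beta$ together with the context/substitution closure of these rules, $\equiv$ its equivalence. Translation: $[\![x]\!]=x$,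 $[\![s]\!]=\mathbf u_s$, $[\![\Pi_{s_1,s_2}(A,x.B)]\!]=\mathbf{Prod}_{s_1,s_2}[\![A]\!](\lambda x:\mathbf{El}_{s_1}[\![A]\!].[\![B]\!])$, $[\![\lambda_{s_1,s_2}(A,x.B,x.M)]\!]=\mathbf{abs}_{s_1,s_2}[\![A]\!](\lambda x:\mathbf{El}_{s_1}[\![A]\!].[\![B]\!])(\lambda x:\mathbf{El}_{s_1}[\![A]\!].[\![M]\!])$, $[\![@_{s_1,s_2}(A,x.B,M,N)]\!]=\mathbf{app}_{s_1,s_2}[\![A]\!](\lambda x:\mathbf{El}_{s_1}[\![A]\!].[\![B]\!])[\![M]\!][\![N]\!]$. -}

module Defs where

open import Data.Nat using (ℕ; zero; suc)
open import Data.Product using (Σ; ∃; _×_; _,_)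
open import Relation.Binary.PropositionalEquality using (_≡_)
open import Relation.Binary.Construct.Closure.ReflexiveTransitive using (Star)
open import Relation.Binary.Construct.Closure.Equivalence using (EqClosure)

record Spec : Set₁ where
  field
    Sort  : Set
    Axiom : Sort → Sort → Set
    Rule  : Sort → Sort → Sort → Set

record Functional (P : Spec) : Set where
  open Spec P
  field
    axiom-fun : ∀ {s₁ s₂ s₂'} → Axiom s₁ s₂ → Axiom s₁ s₂' → s₂ ≡ s₂'
    rule-fun  : ∀ {s₁ s₂ s₃ s₃'} → Rule s₁ s₂ s₃ → Rule s₁ s₂ s₃' → s₃ ≡ s₃'

module Encoding (P : Spec) where
  open Spec P

  -- EPTS terms (de Bruijn indices; "x." binds index 0 in that argument)
  data Tm : Set where
    var  : ℕ → Tm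
    sort : Sort → Tm
    Π    : Sort → Sort → Tm → Tm → Tm               -- Π_{s₁,s₂}(A, x.B)
    lam  : Sort → Sort → Tm → Tm → Tm → Tm          -- λ_{s₁,s₂}(A, x.B, x.M)
    ap   : Sort → Sort → Tm → Tm → Tm → Tm → Tm     -- @_{s₁,s₂}(A, x.B, M, N)

  ext : (ℕ → ℕ) → ℕ → ℕ
  ext ρ zero    = zero
  ext ρ (suc n) = suc (ρ n)

  ren : (ℕ → ℕ) → Tm → Tm
  ren ρ (var n)             = var (ρ n)
  ren ρ (sort s)            = sort s
  ren ρ (Π s₁ s₂ A B)       = Π s₁ s₂ (ren ρ A) (ren (ext ρ) B)
  ren ρ (lam s₁ s₂ A B M)   = lam s₁ s₂ (ren ρ A) (ren (ext ρ) B) (ren (ext ρ) M)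
  ren ρ (ap s₁ s₂ A B M N)  = ap s₁ s₂ (ren ρ A) (ren (ext ρ) B) (ren ρ M) (ren ρ N)

  exts : (ℕ → Tm) → ℕ → Tm
  exts σ zero    = var zero
  exts σ (suc n) = ren suc (σ n)

  sub : (ℕ → Tm) → Tm → Tm
  sub σ (var n)             = σ n
  sub σ (sort s)            = sort s
  sub σ (Π s₁ s₂ A B)       = Π s₁ s₂ (sub σ A) (sub (exts σ) B)
  sub σ (lam s₁ s₂ A B M)   = lam s₁ s₂ (sub σ A) (sub (exts σ) B) (sub (exts σ) M)
  sub σ (ap s₁ s₂ A B M N)  = ap s₁ s₂ (sub σ A) (sub (exts σ) B) (sub σ M) (sub σ N)

  single : Tm → ℕ → Tm
  single N zero    = N
  single N (suc n) = var n

  _[_] : Tm → Tm → Tm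
  M [ N ] = sub (single N) M

  infix 4 _↪_
  data _↪_ : Tm → Tm → Set where
    beta : ∀ {s₁ s₂ s₃ A B A' B' M N} → Rule s₁ s₂ s₃ →
           ap s₁ s₂ A B (lam s₁ s₂ A' B' M) N ↪ M [ N ]
    Π₁   : ∀ {s₁ s₂ A A' B} → A ↪ A' → Π s₁ s₂ A B ↪ Π s₁ s₂ A' B
    Π₂   : ∀ {s₁ s₂ A B B'} → B ↪ B' → Π s₁ s₂ A B ↪ Π s₁ s₂ A B'
    lam₁ : ∀ {s₁ s₂ A A' B M} → A ↪ A' → lam s₁ s₂ A B M ↪ lam s₁ s₂ A' B M
    lam₂ : ∀ {s₁ s₂ A B B' M} → B ↪ B' → lam s₁ s₂ A B M ↪ lam s₁ s₂ A B' M
    lam₃ : ∀ {s₁ s₂ A B M M'} → M ↪ M' → lam s₁ s₂ A B M ↪ lam s₁ s₂ A B M'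
    ap₁  : ∀ {s₁ s₂ A A' B M N} → A ↪ A' → ap s₁ s₂ A B M N ↪ ap s₁ s₂ A' B M N
    ap₂  : ∀ {s₁ s₂ A B B' M N} → B ↪ B' → ap s₁ s₂ A B M N ↪ ap s₁ s₂ A B' M N
    ap₃  : ∀ {s₁ s₂ A B M M' N} → M ↪ M' → ap s₁ s₂ A B M N ↪ ap s₁ s₂ A B M' N
    ap₄  : ∀ {s₁ s₂ A B M N N'} → N ↪ N' → ap s₁ s₂ A B M N ↪ ap s₁ s₂ A B M N'

  infix 4 _≡ₑ_
  _≡ₑ_ : Tm → Tm → Set
  _≡ₑ_ = EqClosure _↪_

  data Const : Set where
    U    : Sort → Const
    El   : Sort → Const
    u    : Sort → Const
    Prod : Sort → Sort → Const
    abs  : Sort → Sort → Const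
    app  : Sort → Sort → Const

  data DTm : Set where
    dvar   : ℕ → DTm
    dconst : Const → DTm
    dType  : DTm
    dKind  : DTm
    dPi    : DTm → DTm → DTm      -- Πx:A.B   (B binds index 0)
    dlam   : DTm → DTm → DTm      -- λx:A.M   (M binds index 0)
    _·_    : DTm → DTm → DTm
  infixl 9 _·_

  dren : (ℕ → ℕ) → DTm → DTm
  dren ρ (dvar n)   = dvar (ρ n)
  dren ρ (dconst c) = dconst c
  dren ρ dType      = dType
  dren ρ dKind      = dKind
  dren ρ (dPi A B)  = dPi (dren ρ A) (dren (ext ρ) B)
  dren ρ (dlam A M) = dlam (dren ρ A) (dren (ext ρ) M)
  dren ρ (M · N)    = dren ρ M · dren ρ N

  dexts : (ℕ → DTm) → ℕ → DTm
  dexts σ zero    = dvar zero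
  dexts σ (suc n) = dren suc (σ n)

  dsub : (ℕ → DTm) → DTm → DTm
  dsub σ (dvar n)   = σ n
  dsub σ (dconst c) = dconst c
  dsub σ dType      = dType
  dsub σ dKind      = dKind
  dsub σ (dPi A B)  = dPi (dsub σ A) (dsub (dexts σ) B)
  dsub σ (dlam A M) = dlam (dsub σ A) (dsub (dexts σ) M)
  dsub σ (M · N)    = dsub σ M · dsub σ N

  dsingle : DTm → ℕ → DTm
  dsingle N zero    = N
  dsingle N (suc n) = dvar n

  _⟨_⟩ : DTm → DTm → DTm
  M ⟨ N ⟩ = dsub (dsingle N) M

  -- Head steps: β and (instances of) the rewrite rules of R_EPTS.
  -- Pattern variables are instantiated by arbitrary terms (substitution closure).
  data _▷_ : DTm → DTm → Set where
    β     : ∀ {A M N} → (dlam A M · N) ▷ (M ⟨ N ⟩)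
    El-u  : ∀ {s₁ s₂} → Axiom s₁ s₂ →
            (dconst (El s₂) · dconst (u s₁)) ▷ dconst (U s₁)
    app-abs : ∀ {s₁ s₂ s₃ A B A' B' M N} → Rule s₁ s₂ s₃ →
            (dconst (app s₁ s₂) · A · B · (dconst (abs s₁ s₂) · A' · B' · M) · N)
              ▷ (M · N)

  infix 4 _⟶_
  data _⟶_ : DTm → DTm → Set where
    head  : ∀ {M N} → M ▷ N → M ⟶ N
    Pi₁   : ∀ {A A' B} → A ⟶ A' → dPi A B ⟶ dPi A' B
    Pi₂   : ∀ {A B B'} → B ⟶ B' → dPi A B ⟶ dPi A B'
    lam₁  : ∀ {A A' M} → A ⟶ A' → dlam A M ⟶ dlam A' M
    lam₂  : ∀ {A M M'} → M ⟶ M' → dlam A M ⟶ dlam A M'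
    app₁  : ∀ {M M' N} → M ⟶ M' → M · N ⟶ M' · N
    app₂  : ∀ {M N N'} → N ⟶ N' → M · N ⟶ M · N'

  infix 4 _⟶*_
  _⟶*_ : DTm → DTm → Set
  _⟶*_ = Star _⟶_

  infix 4 _≡d_
  _≡d_ : DTm → DTm → Set
  _≡d_ = EqClosure _⟶_

  ⟦_⟧ : Tm → DTm
  ⟦ var n ⟧            = dvar n
  ⟦ sort s ⟧           = dconst (u s)
  ⟦ Π s₁ s₂ A B ⟧      = dconst (Prod s₁ s₂) · ⟦ A ⟧
                           · dlam (dconst (El s₁) · ⟦ A ⟧) ⟦ B ⟧
  ⟦ lam s₁ s₂ A B M ⟧  = dconst (abs s₁ s₂) · ⟦ A ⟧
                           · dlam (dconst (El s₁) · ⟦ A ⟧) ⟦ B ⟧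
                           · dlam (dconst (El s₁) · ⟦ A ⟧) ⟦ M ⟧
  ⟦ ap s₁ s₂ A B M N ⟧ = dconst (app s₁ s₂) · ⟦ A ⟧
                           · dlam (dconst (El s₁) · ⟦ A ⟧) ⟦ B ⟧
                           · ⟦ M ⟧ · ⟦ N ⟧

-- The translation commutes with renaming and substitution, so an EPTS β-step
-- @(A, x.B, λ(A', x.B', x.M), N) ↪ M{N/x} becomes the app/abs rewrite step
-- followed by one Dedukti β-step; the congruence cases are simulated inside
-- the corresponding Dedukti contexts.  Conversion then follows because ⟦_⟧
-- maps each ↪-step into the equivalence ≡d.
module Submission where

open import Defs
open import Data.Nat using (ℕ; zero; suc)
open import Data.Product using (_×_; _,_)
open import Function using (_∘_)
open import Relation.Binary.PropositionalEquality using (_≡_; refl; cong; cong₂; trans)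
open import Relation.Binary.Construct.Closure.ReflexiveTransitive using (ε; _◅_; _◅◅_; gmap)
open import Relation.Binary.Construct.Closure.Equivalence using (isEquivalence; gfold)
open import Relation.Binary.Construct.Closure.Equivalence.Properties using (a—↠b⇒a↔b)

module EncodingProperties (P : Spec) where
  open Encoding P

  ⟦⟧-ren : ∀ ρ M → ⟦ ren ρ M ⟧ ≡ dren ρ ⟦ M ⟧
  ⟦⟧-ren ρ (var n) = refl
  ⟦⟧-ren ρ (sort s) = refl
  ⟦⟧-ren ρ (Π s₁ s₂ A B)
    rewrite ⟦⟧-ren ρ A | ⟦⟧-ren (ext ρ) B = refl
  ⟦⟧-ren ρ (lam s₁ s₂ A B M)
    rewrite ⟦⟧-ren ρ A | ⟦⟧-ren (ext ρ) B | ⟦⟧-ren (ext ρ) M = refl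
  ⟦⟧-ren ρ (ap s₁ s₂ A B M N)
    rewrite ⟦⟧-ren ρ A | ⟦⟧-ren (ext ρ) B | ⟦⟧-ren ρ M | ⟦⟧-ren ρ N = refl

  dexts-cong : ∀ {σ τ} → (∀ n → σ n ≡ τ n) → ∀ n → dexts σ n ≡ dexts τ n
  dexts-cong σ≗τ zero    = refl
  dexts-cong σ≗τ (suc n) = cong (dren suc) (σ≗τ n)

  dsub-cong : ∀ {σ τ} → (∀ n → σ n ≡ τ n) → ∀ M → dsub σ M ≡ dsub τ M
  dsub-cong σ≗τ (dvar n)   = σ≗τ n
  dsub-cong σ≗τ (dconst c) = refl
  dsub-cong σ≗τ dType      = refl
  dsub-cong σ≗τ dKind      = refl
  dsub-cong σ≗τ (dPi A B)  = cong₂ dPi (dsub-cong σ≗τ A) (dsub-cong (dexts-cong σ≗τ) B)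
  dsub-cong σ≗τ (dlam A M) = cong₂ dlam (dsub-cong σ≗τ A) (dsub-cong (dexts-cong σ≗τ) M)
  dsub-cong σ≗τ (M · N)    = cong₂ _·_ (dsub-cong σ≗τ M) (dsub-cong σ≗τ N)

  ⟦_⟧ˢ : (ℕ → Tm) → ℕ → DTm
  ⟦ σ ⟧ˢ n = ⟦ σ n ⟧

  ⟦⟧-exts : ∀ σ n → ⟦ exts σ ⟧ˢ n ≡ dexts ⟦ σ ⟧ˢ n
  ⟦⟧-exts σ zero    = refl
  ⟦⟧-exts σ (suc n) = ⟦⟧-ren suc (σ n)

  ⟦⟧-sub      : ∀ σ M → ⟦ sub σ M ⟧ ≡ dsub ⟦ σ ⟧ˢ ⟦ M ⟧
  ⟦⟧-sub-exts : ∀ σ M → ⟦ sub (exts σ) M ⟧ ≡ dsub (dexts ⟦ σ ⟧ˢ) ⟦ M ⟧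

  ⟦⟧-sub σ (var n) = refl
  ⟦⟧-sub σ (sort s) = refl
  ⟦⟧-sub σ (Π s₁ s₂ A B)
    rewrite ⟦⟧-sub σ A | ⟦⟧-sub-exts σ B = refl
  ⟦⟧-sub σ (lam s₁ s₂ A B M)
    rewrite ⟦⟧-sub σ A | ⟦⟧-sub-exts σ B | ⟦⟧-sub-exts σ M = refl
  ⟦⟧-sub σ (ap s₁ s₂ A B M N)
    rewrite ⟦⟧-sub σ A | ⟦⟧-sub-exts σ B | ⟦⟧-sub σ M | ⟦⟧-sub σ N = refl

  ⟦⟧-sub-exts σ M = trans (⟦⟧-sub (exts σ) M) (dsub-cong (⟦⟧-exts σ) ⟦ M ⟧)

  ⟦⟧-single : ∀ N n → ⟦ single N ⟧ˢ n ≡ dsingle ⟦ N ⟧ n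
  ⟦⟧-single N zero    = refl
  ⟦⟧-single N (suc n) = refl

  ⟦⟧-[] : ∀ M N → ⟦ M [ N ] ⟧ ≡ ⟦ M ⟧ ⟨ ⟦ N ⟧ ⟩
  ⟦⟧-[] M N = trans (⟦⟧-sub (single N) M) (dsub-cong (⟦⟧-single N) ⟦ M ⟧)

  ⟶*-cong : (f : DTm → DTm) → (∀ {x y} → x ⟶ y → f x ⟶ f y) →
            ∀ {x y} → x ⟶* y → f x ⟶* f y
  ⟶*-cong f f-mono = gmap f f-mono

  -- A occurs several times in the translation (also in the El-annotations of
  -- the binders), so a step in A is simulated once per occurrence.
  ⟦⟧-step : ∀ {M N} → M ↪ N → ⟦ M ⟧ ⟶* ⟦ N ⟧
  ⟦⟧-step (beta {M = M} {N = N} r) rewrite ⟦⟧-[] M N =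
    head (app-abs r) ◅ head β ◅ ε
  ⟦⟧-step (Π₁ s) =
    ⟶*-cong _ (λ x → app₁ (app₂ x)) (⟦⟧-step s) ◅◅
    ⟶*-cong _ (λ x → app₂ (lam₁ (app₂ x))) (⟦⟧-step s)
  ⟦⟧-step (Π₂ s) = ⟶*-cong _ (λ x → app₂ (lam₂ x)) (⟦⟧-step s)
  ⟦⟧-step (lam₁ s) =
    ⟶*-cong _ (λ x → app₁ (app₁ (app₂ x))) (⟦⟧-step s) ◅◅
    ⟶*-cong _ (λ x → app₁ (app₂ (lam₁ (app₂ x)))) (⟦⟧-step s) ◅◅
    ⟶*-cong _ (λ x → app₂ (lam₁ (app₂ x))) (⟦⟧-step s)
  ⟦⟧-step (lam₂ s) = ⟶*-cong _ (λ x → app₁ (app₂ (lam₂ x))) (⟦⟧-step s)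
  ⟦⟧-step (lam₃ s) = ⟶*-cong _ (λ x → app₂ (lam₂ x)) (⟦⟧-step s)
  ⟦⟧-step (ap₁ s) =
    ⟶*-cong _ (λ x → app₁ (app₁ (app₁ (app₂ x)))) (⟦⟧-step s) ◅◅
    ⟶*-cong _ (λ x → app₁ (app₁ (app₂ (lam₁ (app₂ x))))) (⟦⟧-step s)
  ⟦⟧-step (ap₂ s) = ⟶*-cong _ (λ x → app₁ (app₁ (app₂ (lam₂ x)))) (⟦⟧-step s)
  ⟦⟧-step (ap₃ s) = ⟶*-cong _ (λ x → app₁ (app₂ x)) (⟦⟧-step s)
  ⟦⟧-step (ap₄ s) = ⟶*-cong _ app₂ (⟦⟧-step s)

  ⟦⟧-conv : ∀ {M N} → M ≡ₑ N → ⟦ M ⟧ ≡d ⟦ N ⟧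
  ⟦⟧-conv = gfold (isEquivalence _⟶_) ⟦_⟧ (a—↠b⇒a↔b ∘ ⟦⟧-step)

mainTheorem10 : (P : Spec) → Functional P →
    let open Encoding P in
    (∀ (M N : Tm) → M ↪ N → ⟦ M ⟧ ⟶* ⟦ N ⟧) ×
    (∀ (M N : Tm) → M ≡ₑ N → ⟦ M ⟧ ≡d ⟦ N ⟧)
mainTheorem10 P _ = (λ _ _ → ⟦⟧-step) , (λ _ _ → ⟦⟧-conv)
  where open EncodingProperties P
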